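{- Let $\eta$ be the IF sentence $$\forall x\big(\forall y(\exists u/\{x\})\epsilon_1\lor\forall z(\exists v/\{x\})\epsilon_2\big),$$ where $\epsilon_1 := (A(x)\land\mathcal{B}(y))\to(u\neq x\land R_\in(u,y))$ and $\epsilon_2 := (A(x)\land\mathcal{B}(z))\to(v\neq x\land R_\in(v,z))$. For every suitable structure $M$, $M\models\eta$ iff $M$ encodes a "yes" instance of SET SPLITTING.
   Context: IF team semantics: a team is a set of assignments with common finite domain; quantifier-free formulas ($\to$ classical) hold in a team iff in every assignment; $\psi\lor\chi$ holds in $X$ iff $X=Y\cup Z$ with $Y\models\psi$, $Z\models\chi$; $\forall v\psi$ in $X$ iff $X[M/v]=\{s(a/v):s\in X,a\in M\}\models\psi$; $(\exists v/V)\psi$ in $X$ iff $\{s(F(s)/v):s\in X\}\models\psi$ for some $V$-uniform $F:X\to M$ ($F(s)=F(s')$ whenever $s,s'$ agree outside $V$). $M\models\varphi$ iff $M,\{\emptyset\}\models\varphi$. SET SPLITTING (restricted): input a set $A$ and a family $\mathcal{B}\subseteq\wp(A)$ with every $B\in\mathcal{B}$ of cardinality at least 2; "yes" iff there is a partition $\{U,V\}$ of $A$ with $B\cap U\neq\emptyset$ and $B\cap V\neq\emptyset$ for all $B\in\mathcal{B}$. A suitable structure encoding $(A,\mathcal{B})$ has domain $A\cup\mathcal{B}$, unary predicates $A$ and $\mathcal{B}$ interpreted as these sets, and a binary relation $R_\in$ with $(a,B)\in R_\in$ iff $a\in A$, $B\in\mathcal{B}$ and $a\in B$. -}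

module Defs where

open import Data.Nat using (ℕ; _≤_)
open import Data.Fin using (Fin; zero) renaming (suc to fsuc)
open import Data.Fin.Subset using (Subset; _∈_; _∉_; _∪_; _∩_; ⊤; ⊥; Nonempty; ⁅_⁆)
open import Data.Maybe using (Maybe; just; nothing)
open import Data.Vec using (Vec; lookup; replicate; _[_]≔_)
open import Data.Product using (Σ; Σ-syntax; _×_)
open import Data.Sum using (_⊎_; inj₁; inj₂)
open import Relation.Nullary using (¬_)
open import Relation.Binary.PropositionalEquality using (_≡_)
open import Function.Bundles using (_⇔_)
open import Level using (Lift; suc; 0ℓ)

record Structure : Set₁ where
  field
    Carrier : Set
    PA  : Carrier → Set
    P𝓑  : Carrier → Set
    PR∈ : Carrier → Carrier → Set

infixr 6 _∧'_
infixr 5 _→'_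
infix  7 _≐_

data QF (k : ℕ) : Set where
  A'   : Fin k → QF k
  𝓑'   : Fin k → QF k
  R∈'  : Fin k → Fin k → QF k
  _≐_  : Fin k → Fin k → QF k
  ¬'_  : QF k → QF k
  _∧'_ : QF k → QF k → QF k
  _→'_ : QF k → QF k → QF k

data IF (k : ℕ) : Set where
  qf   : QF k → IF k
  _∨'_ : IF k → IF k → IF k
  ∀'   : Fin k → IF k → IF k
  ∃/   : Fin k → Subset k → IF k → IF k

-- Team semantics.  An assignment is a partial map Fin k → M
-- (nothing = variable not in the domain); a team is a set
-- (predicate) of assignments.

Asg : Set → ℕ → Set
Asg M k = Vec (Maybe M) k

Team : Set → ℕ → Set₁
Team M k = Asg M k → Set

module Semantics (𝔐 : Structure) where
  open Structure 𝔐 renaming (Carrier to M)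

  _↦_∈_ : ∀ {k} → Fin k → M → Asg M k → Set
  x ↦ d ∈ s = lookup s x ≡ just d

  ⟦_⟧ : ∀ {k} → QF k → Asg M k → Set
  ⟦ A' x ⟧ s = Σ[ d ∈ M ] (x ↦ d ∈ s × PA d)
  ⟦ 𝓑' x ⟧ s = Σ[ d ∈ M ] (x ↦ d ∈ s × P𝓑 d)
  ⟦ R∈' x y ⟧ s = Σ[ d ∈ M ] Σ[ e ∈ M ] (x ↦ d ∈ s × y ↦ e ∈ s × PR∈ d e)
  ⟦ x ≐ y ⟧ s = Σ[ d ∈ M ] Σ[ e ∈ M ] (x ↦ d ∈ s × y ↦ e ∈ s × d ≡ e)
  ⟦ ¬' φ ⟧ s = ¬ ⟦ φ ⟧ s
  ⟦ φ ∧' ψ ⟧ s = ⟦ φ ⟧ s × ⟦ ψ ⟧ s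
  ⟦ φ →' ψ ⟧ s = ⟦ φ ⟧ s → ⟦ ψ ⟧ s

  AgreeOutside : ∀ {k} → Subset k → Asg M k → Asg M k → Set
  AgreeOutside V s s' = ∀ i → i ∉ V → lookup s i ≡ lookup s' i

  _⊨_ : ∀ {k} → Team M k → IF k → Set₁
  X ⊨ qf φ = Lift (suc 0ℓ) (∀ s → X s → ⟦ φ ⟧ s)
  X ⊨ (ψ ∨' χ) =
    Σ[ Y ∈ Team M _ ] Σ[ Z ∈ Team M _ ]
      ((∀ s → X s ⇔ (Y s ⊎ Z s)) × Y ⊨ ψ × Z ⊨ χ)
  X ⊨ ∀' v ψ = (λ t → Σ[ s ∈ Asg M _ ] Σ[ a ∈ M ] (X s × t ≡ s [ v ]≔ just a)) ⊨ ψ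
  X ⊨ ∃/ v V ψ =
    Σ[ F ∈ ((s : Asg M _) → X s → M) ]
      ((∀ s s' (p : X s) (p' : X s') → AgreeOutside V s s' → F s p ≡ F s' p')
      × ((λ t → Σ[ s ∈ Asg M _ ] Σ[ p ∈ X s ] (t ≡ s [ v ]≔ just (F s p))) ⊨ ψ))

  ⊨ˢ : ∀ {k} → IF k → Set₁
  ⊨ˢ {k} φ = (λ s → s ≡ replicate k nothing) ⊨ φ

vx vy vu vz vv : Fin 5
vx = zero
vy = fsuc zero
vu = fsuc (fsuc zero)
vz = fsuc (fsuc (fsuc zero))
vv = fsuc (fsuc (fsuc (fsuc zero)))

ε₁ ε₂ : QF 5
ε₁ = (A' vx ∧' 𝓑' vy) →' (¬' (vu ≐ vx) ∧' R∈' vu vy)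
ε₂ = (A' vx ∧' 𝓑' vz) →' (¬' (vv ≐ vx) ∧' R∈' vv vz)

η : IF 5
η = ∀' vx (∀' vy (∃/ vu ⁅ vx ⁆ (qf ε₁)) ∨' ∀' vz (∃/ vv ⁅ vx ⁆ (qf ε₂)))

-- SET SPLITTING instances: A = Fin n, 𝓑 given by an injective
-- indexing 𝓑 : Fin m → Subset n.

data Enc∈ {n m : ℕ} (𝓑 : Fin m → Subset n) : Fin n ⊎ Fin m → Fin n ⊎ Fin m → Set where
  mem : ∀ {a j} → a ∈ 𝓑 j → Enc∈ 𝓑 (inj₁ a) (inj₂ j)

data IsA {n m : ℕ} : Fin n ⊎ Fin m → Set where
  isA : ∀ a → IsA (inj₁ a)

data Is𝓑 {n m : ℕ} : Fin n ⊎ Fin m → Set where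
  is𝓑 : ∀ j → Is𝓑 (inj₂ j)

encode : (n m : ℕ) → (Fin m → Subset n) → Structure
encode n m 𝓑 = record
  { Carrier = Fin n ⊎ Fin m
  ; PA = IsA
  ; P𝓑 = Is𝓑
  ; PR∈ = Enc∈ 𝓑
  }

SetSplittingYes : (n m : ℕ) → (Fin m → Subset n) → Set
SetSplittingYes n m 𝓑 =
  Σ[ U ∈ Subset n ] Σ[ V ∈ Subset n ]
    (U ∪ V ≡ ⊤ × U ∩ V ≡ ⊥ ×
     (∀ j → Nonempty (𝓑 j ∩ U) × Nonempty (𝓑 j ∩ V)))

module Submission where

-- Both disjuncts have the shape  ∀w (∃t/{x}) ε(x,w,t)  with
-- ε(x,w,t) = (A x ∧ 𝓑 w) → (t ≠ x ∧ t ∈ w).  Evaluated on a team Y of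
-- assignments {x ↦ d}, such a disjunct chooses for every block w a member t
-- that may not depend on x; hence t must differ from EVERY point x of Y.
-- So the disjunct holds on Y exactly when every block has a member outside
-- the points of Y (lemmas `escape` and `realise`, proved once for an
-- arbitrary triple of distinct variables and used for both disjuncts).
--
-- ⊨ η splits the team {x ↦ d | d ∈ M} into Y ∪ Z.  Colouring each point by
-- the side of this cover (module `Colouring`) gives a partition U, ∁ U, and
-- the two escape properties force every block to meet both colours
-- (`Colouring.splits`).  Conversely a splitting partition U, V yields the
-- teams Y = points of U together with the blocks, Z = the other points, on
-- which the disjuncts are realised by picking a member of V resp. U.

open import Defs
open import Data.Nat using (ℕ; _≤_)
open import Data.Fin using (Fin)
open import Data.Fin.Subset using (Subset; ∣_∣)
open import Relation.Binary.PropositionalEquality using (_≡_)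
open import Function.Definitions using (Injective)
open import Function.Bundles using (_⇔_)

open import Data.Nat using (_<_; s≤s; z≤n)
open import Data.Nat.Properties using (≤-trans; n≮0)
open import Data.Fin using (_≟_)
open import Data.Fin.Subset using (_∈_; _∉_; ∁; _∩_; Nonempty; ⁅_⁆; Side; inside; outside)
open import Data.Fin.Subset.Properties
  using (x∉⁅y⁆⇒x≢y; x≢y⇒x∉⁅y⁆; x∉p⇒x∈∁p; p∪∁p≡⊤; ∩-inverseʳ; x∈p∩q⁺; x∈p∩q⁻; ∉⊥; _∈?_; nonempty?; Empty-unique; ∣⊥∣≡0)
open import Data.Maybe using (Maybe; just; nothing)
open import Data.Maybe.Properties using (just-injective)
open import Data.Vec using (Vec; lookup; tabulate; replicate; _[_]≔_)
open import Data.Vec.Properties using (lookup∘update; lookup∘update′; lookup∘tabulate; lookup⇒[]=; []=⇒lookup)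
open import Data.Product using (Σ-syntax; _×_; _,_; proj₁; proj₂)
open import Data.Sum using (_⊎_; inj₁; inj₂; [_,_]′; fromInj₁; fromInj₂)
open import Data.Unit using (⊤; tt)
open import Function using (const; _∘_)
open import Relation.Nullary using (¬_; Dec; yes; no; contradiction)
open import Relation.Binary.PropositionalEquality using (_≢_; refl; sym; trans; cong; subst; subst₂; module ≡-Reasoning)
open import Function.Bundles using (mk⇔; Equivalence)
open import Level using (lift)

update-agrees : ∀ {A : Set} {k} {V : Subset k} (s s' : Vec A k) →
  (∀ i → i ∉ V → lookup s i ≡ lookup s' i) →
  ∀ j a i → i ∉ V → lookup (s [ j ]≔ a) i ≡ lookup (s' [ j ]≔ a) i
update-agrees s s' agree j a i i∉V with i ≟ j
... | yes refl = trans (lookup∘update i s a) (sym (lookup∘update i s' a))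
... | no i≢j = begin
  lookup (s [ j ]≔ a) i   ≡⟨ lookup∘update′ i≢j s a ⟩
  lookup s i              ≡⟨ agree i i∉V ⟩
  lookup s' i             ≡⟨ sym (lookup∘update′ i≢j s' a) ⟩
  lookup (s' [ j ]≔ a) i  ∎
  where open ≡-Reasoning

updates-agree-outside : ∀ {A : Set} {k} (s : Vec A k) (x : Fin k) a b →
  ∀ i → i ∉ ⁅ x ⁆ → lookup (s [ x ]≔ a) i ≡ lookup (s [ x ]≔ b) i
updates-agree-outside s x a b i i∉⁅x⁆ =
  trans (lookup∘update′ i≢x s a) (sym (lookup∘update′ i≢x s b))
  where i≢x = x∉⁅y⁆⇒x≢y i∉⁅x⁆

same-value : ∀ {A : Set} {value : Maybe A} {a b : A} → value ≡ just a → value ≡ just b → a ≡ b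
same-value ↦a ↦b = just-injective (trans (sym ↦a) ↦b)

positive⇒nonempty : ∀ {n} (p : Subset n) → 0 < ∣ p ∣ → Nonempty p
positive⇒nonempty {n} p positive with nonempty? p
... | yes nonempty = nonempty
... | no empty = contradiction
  (subst (0 <_) (∣⊥∣≡0 n) (subst (λ q → 0 < ∣ q ∣) (Empty-unique empty) positive)) n≮0

-- B escapes P: as soon as P has an element, B has an element outside P.
-- This is what a disjunct of η says about the block B and the points of its team.
Escapes : ∀ {n} → (Fin n → Set) → Subset n → Set
Escapes {n} P B = ∀ a → P a → Σ[ c ∈ Fin n ] (c ∈ B × ¬ P c)

module Colouring {n} {P Q : Fin n → Set} (cover : ∀ a → P a ⊎ Q a) where

  sideOf : ∀ {a} → P a ⊎ Q a → Side
  sideOf = [ const inside , const outside ]′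

  U : Subset n
  U = tabulate (sideOf ∘ cover)

  colour : ∀ a → lookup U a ≡ sideOf (cover a)
  colour = lookup∘tabulate (sideOf ∘ cover)

  ¬Q⇒∈U : ∀ {a} → ¬ Q a → a ∈ U
  ¬Q⇒∈U {a} ¬q with cover a in eq
  ... | inj₁ _ = lookup⇒[]= a U (trans (colour a) (cong sideOf eq))
  ... | inj₂ q = contradiction q ¬q

  ¬P⇒∈∁U : ∀ {a} → ¬ P a → a ∈ ∁ U
  ¬P⇒∈∁U {a} ¬p with cover a in eq
  ... | inj₁ p = contradiction p ¬p
  ... | inj₂ _ = x∉p⇒x∈∁p λ a∈U →
    outside≢inside (trans (sym (trans (colour a) (cong sideOf eq))) ([]=⇒lookup a∈U))
    where
    outside≢inside : outside ≢ inside
    outside≢inside ()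

  -- If B escapes both P and Q, then B meets both colours: starting from any
  -- point, escaping P lands in ∁ U on the Q side, and escaping Q from there
  -- lands in U (and symmetrically).
  splits : (B : Subset n) → Escapes P B → Escapes Q B → Fin n →
    Nonempty (B ∩ U) × Nonempty (B ∩ ∁ U)
  splits B escapeP escapeQ a with cover a
  ... | inj₁ p =
    let (c , c∈B , ¬pc) = escapeP a p
        (d , d∈B , ¬qd) = escapeQ c (fromInj₂ (λ pc → contradiction pc ¬pc) (cover c))
    in (d , x∈p∩q⁺ (d∈B , ¬Q⇒∈U ¬qd)) , (c , x∈p∩q⁺ (c∈B , ¬P⇒∈∁U ¬pc))
  ... | inj₂ q =
    let (c , c∈B , ¬qc) = escapeQ a q
        (d , d∈B , ¬pd) = escapeP c (fromInj₁ (λ qc → contradiction qc ¬qc) (cover c))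
    in (c , x∈p∩q⁺ (c∈B , ¬Q⇒∈U ¬qc)) , (d , x∈p∩q⁺ (d∈B , ¬P⇒∈∁U ¬pd))

member-of-block : ∀ {n m} {𝓑 : Fin m → Subset n} {e j} →
  Enc∈ 𝓑 e (inj₂ j) → Σ[ c ∈ Fin n ] (e ≡ inj₁ c × c ∈ 𝓑 j)
member-of-block (mem c∈B) = _ , refl , c∈B

module WitnessDisjunct {n m : ℕ} (𝓑 : Fin m → Subset n)
  {k : ℕ} (x w t : Fin k) (x≢w : x ≢ w) (x≢t : x ≢ t) (w≢t : w ≢ t) where

  open Semantics (encode n m 𝓑)

  M : Set
  M = Fin n ⊎ Fin m

  witness : QF k
  witness = (A' x ∧' 𝓑' w) →' (¬' (t ≐ x) ∧' R∈' t w)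

  disjunct : IF k
  disjunct = ∀' w (∃/ t ⁅ x ⁆ (qf witness))

  point : M → Asg M k
  point d = replicate k nothing [ x ]≔ just d

  points : (M → Set) → Team M k
  points P s = Σ[ d ∈ M ] (P d × s ≡ point d)

  probe : M → M → M → Asg M k
  probe d b c = point d [ w ]≔ just b [ t ]≔ just c

  probe-x : ∀ d b c → lookup (probe d b c) x ≡ just d
  probe-x d b c = begin
    lookup (probe d b c) x                ≡⟨ lookup∘update′ x≢t (point d [ w ]≔ just b) (just c) ⟩
    lookup (point d [ w ]≔ just b) x      ≡⟨ lookup∘update′ x≢w (point d) (just b) ⟩
    lookup (point d) x                    ≡⟨ lookup∘update x (replicate k nothing) (just d) ⟩
    just d                                ∎
    where open ≡-Reasoning

  probe-w : ∀ d b c → lookup (probe d b c) w ≡ just b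
  probe-w d b c = trans (lookup∘update′ w≢t (point d [ w ]≔ just b) (just c)) (lookup∘update w (point d) (just b))

  probe-t : ∀ d b c → lookup (probe d b c) t ≡ just c
  probe-t d b c = lookup∘update t (point d [ w ]≔ just b) (just c)

  witness-at : ∀ d b c → ⟦ witness ⟧ (probe d b c) ⇔ (IsA d → Is𝓑 b → c ≢ d × Enc∈ 𝓑 c b)
  witness-at d b c = mk⇔ to from
    where
    to : ⟦ witness ⟧ (probe d b c) → IsA d → Is𝓑 b → c ≢ d × Enc∈ 𝓑 c b
    to holds isA-d is𝓑-b with holds ((d , probe-x d b c , isA-d) , (b , probe-w d b c , is𝓑-b))
    ... | distinct , (c' , b' , t↦c' , w↦b' , c'∈b') =
      (λ c≡d → distinct (c , d , probe-t d b c , probe-x d b c , c≡d)) ,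
      subst₂ (Enc∈ 𝓑) (same-value t↦c' (probe-t d b c)) (same-value w↦b' (probe-w d b c)) c'∈b'

    from : (IsA d → Is𝓑 b → c ≢ d × Enc∈ 𝓑 c b) → ⟦ witness ⟧ (probe d b c)
    from member ((d' , x↦d' , isA-d') , (b' , w↦b' , is𝓑-b'))
      with same-value (probe-x d b c) x↦d' | same-value (probe-w d b c) w↦b'
    ... | refl | refl =
      let (c≢d , c∈b) = member isA-d' is𝓑-b'
      in (λ { (c' , d'' , t↦c' , x↦d'' , c'≡d'') → c≢d
               (trans (same-value (probe-t d b c) t↦c') (trans c'≡d'' (same-value x↦d'' (probe-x d b c)))) }) ,
         (c , b , probe-t d b c , probe-w d b c , c∈b)

  -- If the disjunct holds on Y, every block escapes the points of Y: the
  -- member chosen for a block is the same for all points of Y, so it is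
  -- different from each of them.
  escape : (Y : Team M k) → Y ⊨ disjunct → ∀ j → Escapes (λ a → Y (point (inj₁ a))) (𝓑 j)
  escape Y (F , uniform , lift holds) j a y =
    let (c , choice≡c , c∈B) = member-of-block (proj₂ (sound a y))
    in c , c∈B , λ y' → proj₁ (sound c y') (trans (choice-uniform c y' a y) choice≡c)
    where
    member : ∀ a → (y : Y (point (inj₁ a))) →
      Σ[ s ∈ Asg M k ] Σ[ b ∈ M ] (Y s × point (inj₁ a) [ w ]≔ just (inj₂ j) ≡ s [ w ]≔ just b)
    member a y = point (inj₁ a) , inj₂ j , y , refl

    choice : ∀ a → Y (point (inj₁ a)) → M
    choice a y = F _ (member a y)

    sound : ∀ a y → choice a y ≢ inj₁ a × Enc∈ 𝓑 (choice a y) (inj₂ j)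
    sound a y = Equivalence.to (witness-at (inj₁ a) (inj₂ j) (choice a y))
      (holds _ (_ , member a y , refl)) (isA a) (is𝓑 j)

    choice-uniform : ∀ a y a' y' → choice a y ≡ choice a' y'
    choice-uniform a y a' y' = uniform _ _ (member a y) (member a' y')
      (update-agrees (point (inj₁ a)) (point (inj₁ a')) (updates-agree-outside (replicate k nothing) x (just (inj₁ a)) (just (inj₁ a'))) w (just (inj₂ j)))

  -- Conversely, if every block has a member outside the points of P, choosing
  -- such a member for each block (independently of x) realises the disjunct.
  realise : (P : M → Set) → (∀ j → Σ[ c ∈ Fin n ] (c ∈ 𝓑 j × ¬ P (inj₁ c))) → points P ⊨ disjunct
  realise P escaping = F , uniform , lift holds
    where
    pick : M → M
    pick (inj₁ a) = inj₁ a
    pick (inj₂ j) = inj₁ (proj₁ (escaping j))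

    Extended : Team M k
    Extended u = Σ[ s ∈ Asg M k ] Σ[ b ∈ M ] (points P s × u ≡ s [ w ]≔ just b)

    F : (u : Asg M k) → Extended u → M
    F _ (_ , b , _ , _) = pick b

    uniform : ∀ u u' (p : Extended u) (p' : Extended u') → AgreeOutside ⁅ x ⁆ u u' → F u p ≡ F u' p'
    uniform _ _ (_ , b , (d , _ , refl) , refl) (_ , b' , (d' , _ , refl) , refl) agree =
      cong pick (same-value (lookup∘update w (point d) (just b))
        (trans (agree w (x≢y⇒x∉⁅y⁆ (x≢w ∘ sym))) (lookup∘update w (point d') (just b'))))

    pick-is-witness : ∀ d → P d → ∀ b → IsA d → Is𝓑 b → pick b ≢ d × Enc∈ 𝓑 (pick b) b
    pick-is-witness (inj₁ a) pa (inj₂ j) _ _ =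
      (λ c≡a → proj₂ (proj₂ (escaping j)) (subst P (sym c≡a) pa)) , mem (proj₁ (proj₂ (escaping j)))

    holds : ∀ u → (Σ[ s ∈ Asg M k ] Σ[ p ∈ Extended s ] (u ≡ s [ t ]≔ just (F s p))) → ⟦ witness ⟧ u
    holds _ (_ , (_ , b , (d , pd , refl) , refl) , refl) =
      Equivalence.from (witness-at d b (pick b)) (pick-is-witness d pd b)

module Characterisation (n m : ℕ) (𝓑 : Fin m → Subset n) where
  open Semantics (encode n m 𝓑)
  module Left  = WitnessDisjunct 𝓑 vx vy vu (λ ()) (λ ()) (λ ())
  module Right = WitnessDisjunct 𝓑 vx vz vv (λ ()) (λ ()) (λ ())
  open Left using (M; point)

  -- the team ∀x produces from {∅}: all assignments {x ↦ d}
  AllPoints : Team M 5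
  AllPoints s = Σ[ s₀ ∈ Asg M 5 ] Σ[ d ∈ M ] (s₀ ≡ replicate 5 nothing × s ≡ s₀ [ vx ]≔ just d)

  -- ⊨ η: colour each point by the side of the split {x ↦ d} = Y ∪ Z.
  sound : (∀ j → 2 ≤ ∣ 𝓑 j ∣) → ⊨ˢ η → SetSplittingYes n m 𝓑
  sound large (Y , Z , split , Y⊨ , Z⊨) =
    U , ∁ U , p∪∁p≡⊤ U , ∩-inverseʳ U ,
    λ j → splits (𝓑 j) (Left.escape Y Y⊨ j) (Right.escape Z Z⊨ j) (some-point j)
    where
    cover : ∀ a → Y (point (inj₁ a)) ⊎ Z (point (inj₁ a))
    cover a = Equivalence.to (split _) (_ , inj₁ a , refl , refl)
    open Colouring cover

    some-point : Fin m → Fin n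
    some-point j = proj₁ (positive⇒nonempty (𝓑 j) (≤-trans (s≤s z≤n) (large j)))

  -- A splitting U, V: the left disjunct holds on the points of U and the
  -- blocks, the right one on the remaining points.
  complete : SetSplittingYes n m 𝓑 → ⊨ˢ η
  complete (U , V , _ , disjoint , splitting) =
    Left.points OnLeft , Left.points (¬_ ∘ OnLeft) , (λ s → mk⇔ (divide s) (merge s)) ,
    Left.realise OnLeft outside-U , Right.realise (¬_ ∘ OnLeft) inside-U
    where
    OnLeft : M → Set
    OnLeft (inj₁ a) = a ∈ U
    OnLeft (inj₂ _) = ⊤

    onLeft? : ∀ d → Dec (OnLeft d)
    onLeft? (inj₁ a) = a ∈? U
    onLeft? (inj₂ _) = yes tt

    divide : ∀ s → AllPoints s → Left.points OnLeft s ⊎ Left.points (¬_ ∘ OnLeft) s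
    divide _ (_ , d , refl , refl) with onLeft? d
    ... | yes left = inj₁ (d , left , refl)
    ... | no right = inj₂ (d , right , refl)

    merge : ∀ s → Left.points OnLeft s ⊎ Left.points (¬_ ∘ OnLeft) s → AllPoints s
    merge _ (inj₁ (d , _ , refl)) = _ , d , refl , refl
    merge _ (inj₂ (d , _ , refl)) = _ , d , refl , refl

    outside-U : ∀ j → Σ[ c ∈ Fin n ] (c ∈ 𝓑 j × c ∉ U)
    outside-U j =
      let (c , c∈B∩V) = proj₂ (splitting j)
          (c∈B , c∈V) = x∈p∩q⁻ (𝓑 j) V c∈B∩V
      in c , c∈B , λ c∈U → ∉⊥ (subst (c ∈_) disjoint (x∈p∩q⁺ (c∈U , c∈V)))

    inside-U : ∀ j → Σ[ c ∈ Fin n ] (c ∈ 𝓑 j × ¬ c ∉ U)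
    inside-U j =
      let (c , c∈B∩U) = proj₁ (splitting j)
          (c∈B , c∈U) = x∈p∩q⁻ (𝓑 j) U c∈B∩U
      in c , c∈B , λ c∉U → c∉U c∈U

mainTheorem11 : (n m : ℕ) (𝓑 : Fin m → Subset n) →
    Injective _≡_ _≡_ 𝓑 →
    (∀ j → 2 ≤ ∣ 𝓑 j ∣) →
    Semantics.⊨ˢ (encode n m 𝓑) η ⇔ SetSplittingYes n m 𝓑
mainTheorem11 n m 𝓑 _ large = mk⇔ (sound large) complete
  where open Characterisation n m 𝓑
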